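{- Let $t\geq 2$ be an integer, let $k$ be an even positive integer, and let $G=D(1,2,\dots,t)$. Then $\mathrm{rl}_k(G)\leq \frac t2 k^2+k$.
   Context: For a finite set $D=\{d_1<\dots<d_m\}$ of positive integers, the distance graph $D(d_1,\dots,d_m)$ has vertex set $\mathbb{Z}$, two distinct integers $i,j$ being adjacent iff $|i-j|\in D$. For a connected graph $G$ with graph distance $d(\cdot,\cdot)$ and an integer $k\ge 1$, a radio $k$-labeling of $G$ is a map $c:V(G)\to\mathbb{Z}_{\ge 0}$ such that $|c(u)-c(v)|\geq k+1-d(u,v)$ for all distinct vertices $u,v$. Its span is $\max\{c(x)-c(y): x,y\in V(G)\}$ (a supremum for infinite graphs), and the radio $k$-labeling number $\mathrm{rl}_k(G)$ is the minimum span over all radio $k$-labelings of $G$. -}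

module Defs where

open import Data.Nat using (ℕ; zero; suc; _+_; _*_; _≤_; _<_; ∣_-_∣)
open import Data.Integer using (ℤ) renaming (∣_∣ to absℤ; _-_ to _-ℤ_)
open import Data.List using (List; map; upTo)
open import Data.List.Membership.Propositional using (_∈_)
open import Relation.Binary.PropositionalEquality using (_≡_)
open import Relation.Nullary using (¬_)
open import Data.Product using (Σ; _×_)

data Walk {V : Set} (Adj : V → V → Set) : V → V → ℕ → Set where
  here : ∀ {u} → Walk Adj u u zero
  step : ∀ {u v w n} → Adj u v → Walk Adj v w n → Walk Adj u w (suc n)

IsDistance : {V : Set} → (V → V → Set) → V → V → ℕ → Set
IsDistance Adj u v n = Walk Adj u v n × (∀ m → m < n → ¬ Walk Adj u v m)

DistanceGraph : List ℕ → ℤ → ℤ → Set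
DistanceGraph D i j = (¬ i ≡ j) × (absℤ (i -ℤ j) ∈ D)

oneTo : ℕ → List ℕ
oneTo t = map suc (upTo t)

-- Radio k-labeling: |c(u) - c(v)| ≥ k + 1 - d(u,v) for distinct u, v
-- (stated without truncated subtraction).
IsRadioLabeling : {V : Set} → (V → V → Set) → ℕ → (V → ℕ) → Set
IsRadioLabeling Adj k c =
  ∀ u v n → ¬ u ≡ v → IsDistance Adj u v n → k + 1 ≤ ∣ c u - c v ∣ + n

SpanAtMost : {V : Set} → (V → ℕ) → ℕ → Set
SpanAtMost c B = ∀ x y → c x ≤ c y + B

RadioNumberAtMost : {V : Set} → (V → V → Set) → ℕ → ℕ → Set
RadioNumberAtMost {V} Adj k B =
  Σ (V → ℕ) (λ c → IsRadioLabeling Adj k c × SpanAtMost c B)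

-- For k = 2h, label x ∈ ℤ by c(x) = h · (2x mod N) with the odd modulus N = tk + 3; the span
-- is h(N − 1) = tk²/2 + k.  A walk of length n moves at most tn, so |u − v| ≤ t·d(u,v).  The
-- residues of 2u and 2v differ by e with 2(u − v) ≡ ±e (mod N).  If e ≥ 2 the labels already
-- differ by 2h = k.  Otherwise 2|u − v| lies within e of a nonzero multiple of N, hence is at
-- least N − 1 when e = 1, and at least 2N when e = 0 because N is odd; this forces d(u,v) > h,
-- respectively d(u,v) > 2h.
module Submission where

open import Defs
open import Data.Nat using (ℕ; _+_; _*_; _≤_; _/_)
open import Data.Nat.Divisibility using (_∣_)

open import Data.Nat using (zero; suc; _<_; z≤n; s≤s; s≤s⁻¹; ∣_-_∣; NonZero)
open import Data.Nat.Properties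
open import Data.Nat.DivMod using (m*n/n≡m)
open import Data.Nat.Divisibility using (divides)
import Data.Nat.Tactic.RingSolver as ℕ-Ring
open import Data.Integer as ℤ using (ℤ; +_; _%ℕ_; _/ℕ_)
import Data.Integer.Properties as ℤ
open import Data.Integer.DivMod using (a≡a%ℕn+[a/ℕn]*n; n%ℕd<d)
open import Data.Integer.Tactic.RingSolver using (solve-∀)
open import Data.List.Membership.Propositional using (_∈_)
open import Data.List.Membership.Propositional.Properties using (∈-map⁻; ∈-upTo⁻)
open import Data.Product using (_,_; _×_; ∃-syntax)
open import Data.Sum using (inj₁; inj₂)
open import Data.Empty using (⊥-elim)
open import Relation.Binary.PropositionalEquality

∈-oneTo⇒≤ : ∀ {t d} → d ∈ oneTo t → d ≤ t
∈-oneTo⇒≤ d∈ with ∈-map⁻ suc d∈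
... | _ , i∈ , refl = ∈-upTo⁻ i∈

walk-displacement : ∀ {D t} → (∀ {d} → d ∈ D → d ≤ t) →
                    ∀ {u v n} → Walk (DistanceGraph D) u v n → ℤ.∣ u ℤ.- v ∣ ≤ t * n
walk-displacement D≤t {u} here rewrite ℤ.+-inverseʳ u = z≤n
walk-displacement {t = t} D≤t {u} {v} (step {v = w} {n = n} (_ , uw∈D) walk) = begin
  ℤ.∣ u ℤ.- v ∣                   ≡⟨ cong ℤ.∣_∣ (ℤ.+-minus-telescope u w v) ⟨
  ℤ.∣ (u ℤ.- w) ℤ.+ (w ℤ.- v) ∣   ≤⟨ ℤ.∣i+j∣≤∣i∣+∣j∣ (u ℤ.- w) (w ℤ.- v) ⟩
  ℤ.∣ u ℤ.- w ∣ + ℤ.∣ w ℤ.- v ∣   ≤⟨ +-mono-≤ (D≤t uw∈D) (walk-displacement D≤t walk) ⟩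
  t + t * n                       ≡⟨ *-suc t n ⟨
  t * suc n                       ∎
  where open ≤-Reasoning

∣+m-+n∣≡∣m-n∣ : ∀ m n → ℤ.∣ + m ℤ.- + n ∣ ≡ ∣ m - n ∣
∣+m-+n∣≡∣m-n∣ m n rewrite ℤ.m-n≡m⊖n m n with ≤-total m n
... | inj₁ m≤n = trans (ℤ.∣⊖∣-≤ m≤n) (sym (m≤n⇒∣m-n∣≡n∸m m≤n))
... | inj₂ n≤m = trans (ℤ.∣m⊖n∣≡∣n⊖m∣ m n) (trans (ℤ.∣⊖∣-≤ n≤m) (sym (m≤n⇒∣n-m∣≡n∸m n≤m)))

residues-near-multiple : ∀ a b N .{{_ : NonZero N}} →
  ∃[ A ] A * N ≤ ℤ.∣ a ℤ.- b ∣ + ∣ a %ℕ N - b %ℕ N ∣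
       × ℤ.∣ a ℤ.- b ∣ ≤ ∣ a %ℕ N - b %ℕ N ∣ + A * N
residues-near-multiple a b N =
  ℤ.∣ a /ℕ N ℤ.- b /ℕ N ∣ , lower , upper
  where
    r = + (a %ℕ N) ℤ.- + (b %ℕ N)
    M = (a /ℕ N ℤ.- b /ℕ N) ℤ.* + N

    regroup : ∀ (ra qa rb qb n : ℤ) →
      (ra ℤ.+ qa ℤ.* n) ℤ.- (rb ℤ.+ qb ℤ.* n) ≡ (ra ℤ.- rb) ℤ.+ (qa ℤ.- qb) ℤ.* n
    regroup = solve-∀

    cancel : ∀ (i j : ℤ) → (i ℤ.+ j) ℤ.- i ≡ j
    cancel = solve-∀

    split : a ℤ.- b ≡ r ℤ.+ M
    split = trans (cong₂ ℤ._-_ (a≡a%ℕn+[a/ℕn]*n a N) (a≡a%ℕn+[a/ℕn]*n b N))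
                  (regroup (+ (a %ℕ N)) (a /ℕ N) (+ (b %ℕ N)) (b /ℕ N) (+ N))

    ∣r∣ : ℤ.∣ r ∣ ≡ ∣ a %ℕ N - b %ℕ N ∣
    ∣r∣ = ∣+m-+n∣≡∣m-n∣ (a %ℕ N) (b %ℕ N)

    ∣M∣ : ℤ.∣ M ∣ ≡ ℤ.∣ a /ℕ N ℤ.- b /ℕ N ∣ * N
    ∣M∣ = ℤ.abs-* (a /ℕ N ℤ.- b /ℕ N) (+ N)

    lower : ℤ.∣ a /ℕ N ℤ.- b /ℕ N ∣ * N ≤ ℤ.∣ a ℤ.- b ∣ + ∣ a %ℕ N - b %ℕ N ∣
    lower = subst₂ _≤_ (trans (cong ℤ.∣_∣ (trans (cong (ℤ._- r) split) (cancel r M))) ∣M∣)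
                       (cong (λ e → ℤ.∣ a ℤ.- b ∣ + e) ∣r∣)
                       (ℤ.∣i-j∣≤∣i∣+∣j∣ (a ℤ.- b) r)

    upper : ℤ.∣ a ℤ.- b ∣ ≤ ∣ a %ℕ N - b %ℕ N ∣ + ℤ.∣ a /ℕ N ℤ.- b /ℕ N ∣ * N
    upper = subst₂ _≤_ (cong ℤ.∣_∣ (sym split)) (cong₂ _+_ ∣r∣ ∣M∣)
                       (ℤ.∣i+j∣≤∣i∣+∣j∣ r M)

2*n≡o*[1+2m]⇒1+2m≤n : ∀ {m n} o → 1 ≤ n → 2 * n ≡ o * suc (2 * m) → suc (2 * m) ≤ n
2*n≡o*[1+2m]⇒1+2m≤n {n = suc _} zero _ ()
2*n≡o*[1+2m]⇒1+2m≤n {m} {n} 1 _ 2n≡1+2m =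
  ⊥-elim (even≢odd n m (trans 2n≡1+2m (+-identityʳ (suc (2 * m)))))
2*n≡o*[1+2m]⇒1+2m≤n {m} {n} (suc (suc o)) _ 2n≡[2+o]*[1+2m] = *-cancelˡ-≤ 2 (begin
  2 * suc (2 * m)           ≤⟨ *-monoˡ-≤ (suc (2 * m)) (s≤s (s≤s (z≤n {o}))) ⟩
  suc (suc o) * suc (2 * m) ≡⟨ 2n≡[2+o]*[1+2m] ⟨
  2 * n                     ∎)
  where open ≤-Reasoning

o*m≈2*n±1⇒m≤2*n+1 : ∀ {m n} o → 1 ≤ n → o * m ≤ 2 * n + 1 → 2 * n ≤ 1 + o * m → m ≤ 2 * n + 1
o*m≈2*n±1⇒m≤2*n+1 zero 1≤n _ 2n≤1 with ≤-trans (*-monoʳ-≤ 2 1≤n) 2n≤1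
... | s≤s ()
o*m≈2*n±1⇒m≤2*n+1 {m} (suc o) _ [1+o]*m≤2n+1 _ = ≤-trans (m≤m+n m (o * m)) [1+o]*m≤2n+1

-- The modulus t k + 3 for k = 2h, written so that its oddness is visible.
radioModulus : ℕ → ℕ → ℕ
radioModulus t h = suc (2 * suc (t * h))

radioModulus-separates : ∀ t h {n D e A} → 1 ≤ D → D ≤ t * n →
  A * radioModulus t h ≤ 2 * D + e → 2 * D ≤ e + A * radioModulus t h →
  h * 2 + 1 ≤ h * e + n
radioModulus-separates t h {n} {D} {zero} {A} 1≤D D≤tn A*N≤2D 2D≤A*N = begin
  h * 2 + 1    ≡⟨ +-comm (h * 2) 1 ⟩
  suc (h * 2)  ≤⟨ 2h<n ⟩
  n            ≡⟨ cong (_+ n) (*-zeroʳ h) ⟨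
  h * 0 + n    ∎
  where
    open ≤-Reasoning
    2D≡A*N : 2 * D ≡ A * radioModulus t h
    2D≡A*N = ≤-antisym 2D≤A*N (subst (A * radioModulus t h ≤_) (+-identityʳ (2 * D)) A*N≤2D)
    2h<n : h * 2 < n
    2h<n = *-cancelˡ-< t (h * 2) n (begin-strict
      t * (h * 2)       ≡⟨ trans (sym (*-assoc t h 2)) (*-comm (t * h) 2) ⟩
      2 * (t * h)       <⟨ *-monoʳ-< 2 (n<1+n (t * h)) ⟩
      2 * suc (t * h)   <⟨ n<1+n _ ⟩
      radioModulus t h  ≤⟨ 2*n≡o*[1+2m]⇒1+2m≤n {suc (t * h)} A 1≤D 2D≡A*N ⟩
      D                 ≤⟨ D≤tn ⟩
      t * n             ∎)
radioModulus-separates t h {n} {D} {1} {A} 1≤D D≤tn A*N≤2D+1 2D≤1+A*N = begin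
  h * 2 + 1      ≡⟨ rearrange h ⟩
  h * 1 + suc h  ≤⟨ +-monoʳ-≤ (h * 1) h<n ⟩
  h * 1 + n      ∎
  where
    open ≤-Reasoning
    rearrange : ∀ h → h * 2 + 1 ≡ h * 1 + suc h
    rearrange = ℕ-Ring.solve-∀
    N≤2D+1 : radioModulus t h ≤ suc (2 * D)
    N≤2D+1 = subst (radioModulus t h ≤_) (+-comm (2 * D) 1) (o*m≈2*n±1⇒m≤2*n+1 A 1≤D A*N≤2D+1 2D≤1+A*N)
    h<n : h < n
    h<n = *-cancelˡ-< t h n (≤-trans (*-cancelˡ-≤ 2 (s≤s⁻¹ N≤2D+1)) D≤tn)
radioModulus-separates t h {n} {D} {suc (suc e)} 1≤D D≤tn _ _ =
  +-mono-≤ (*-monoʳ-≤ h (s≤s (s≤s (z≤n {e})))) (positive-length n D≤tn)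
  where
    positive-length : ∀ n → D ≤ t * n → 1 ≤ n
    positive-length zero D≤t*0 with ≤-trans 1≤D (≤-trans D≤t*0 (≤-reflexive (*-zeroʳ t)))
    ... | ()
    positive-length (suc _) _ = s≤s z≤n

radioLabel : ℕ → ℕ → ℤ → ℕ
radioLabel t h x = h * ((+ 2 ℤ.* x) %ℕ radioModulus t h)

≢⇒∣i-j∣>0 : ∀ {i j} → i ≢ j → 0 < ℤ.∣ i ℤ.- j ∣
≢⇒∣i-j∣>0 {i} {j} i≢j = n≢0⇒n>0 (λ ∣i-j∣≡0 → i≢j (ℤ.i-j≡0⇒i≡j i j (ℤ.∣i∣≡0⇒i≡0 ∣i-j∣≡0)))

∣2i-2j∣≡2∣i-j∣ : ∀ i j → ℤ.∣ + 2 ℤ.* i ℤ.- + 2 ℤ.* j ∣ ≡ 2 * ℤ.∣ i ℤ.- j ∣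
∣2i-2j∣≡2∣i-j∣ i j = trans (cong ℤ.∣_∣ (factor i j)) (ℤ.abs-* (+ 2) (i ℤ.- j))
  where
    factor : ∀ (i j : ℤ) → + 2 ℤ.* i ℤ.- + 2 ℤ.* j ≡ + 2 ℤ.* (i ℤ.- j)
    factor = solve-∀

radioLabel-isRadioLabeling : ∀ t h → IsRadioLabeling (DistanceGraph (oneTo t)) (h * 2) (radioLabel t h)
radioLabel-isRadioLabeling t h u v n u≢v (walk , _)
  with residues-near-multiple (+ 2 ℤ.* u) (+ 2 ℤ.* v) (radioModulus t h)
... | A , lower , upper rewrite ∣2i-2j∣≡2∣i-j∣ u v =
  subst (λ x → h * 2 + 1 ≤ x + n) (*-distribˡ-∣-∣ h _ _)
        (radioModulus-separates t h {A = A} (≢⇒∣i-j∣>0 u≢v) (walk-displacement ∈-oneTo⇒≤ walk) lower upper)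

radioLabel-span : ∀ t h → SpanAtMost (radioLabel t h) ((t * (h * 2) * (h * 2)) / 2 + h * 2)
radioLabel-span t h x y = ≤-trans bounded (m≤n+m _ (radioLabel t h y))
  where
    open ≤-Reasoning
    expand : ∀ t h → h * (2 * suc (t * h)) ≡ t * (h * 2) * h + h * 2
    expand = ℕ-Ring.solve-∀
    bounded : radioLabel t h x ≤ (t * (h * 2) * (h * 2)) / 2 + h * 2
    bounded = begin
      radioLabel t h x                     ≤⟨ *-monoʳ-≤ h (s≤s⁻¹ (n%ℕd<d (+ 2 ℤ.* x) (radioModulus t h))) ⟩
      h * (2 * suc (t * h))                ≡⟨ expand t h ⟩
      t * (h * 2) * h + h * 2              ≡⟨ cong (_+ h * 2) (m*n/n≡m (t * (h * 2) * h) 2) ⟨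
      (t * (h * 2) * h * 2) / 2 + h * 2    ≡⟨ cong (λ m → m / 2 + h * 2) (*-assoc (t * (h * 2)) h 2) ⟩
      (t * (h * 2) * (h * 2)) / 2 + h * 2  ∎

theorem2 : (t k : ℕ) → 2 ≤ t → 1 ≤ k → 2 ∣ k →
    RadioNumberAtMost (DistanceGraph (oneTo t)) k ((t * k * k) / 2 + k)
theorem2 t .(h * 2) _ _ (divides h refl) =
  radioLabel t h , radioLabel-isRadioLabeling t h , radioLabel-span t h
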